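{- For every directed temporal graph $\mathcal{G}=(V,E,\lambda)$ (with non-strict temporal paths) there exists a proper directed temporal graph $\mathcal{H}$ on the same vertex set $V$ such that for every sequence of distinct vertices $(v_0,v_1,\dots,v_k)$, $k\ge1$, there is a non-strict temporal path in $\mathcal{G}$ visiting exactly $v_0,\dots,v_k$ in this order if and only if there is a strict temporal path in $\mathcal{H}$ visiting exactly $v_0,\dots,v_k$ in this order. In particular $\mathcal{G}$ (setting D \& non-strict) and $\mathcal{H}$ (setting D \& proper) are support equivalent.
   Context: A directed temporal graph is a triple $\mathcal{G}=(V,E,\lambda)$ with $V$ a finite vertex set, $E\subseteq\{(u,v)\in V\times V: u\ne v\}$ a set of arcs, and $\lambda$ assigns to each arc a nonempty finite set of time labels (real time labels may be used; they can be renormalized to positive integers preserving order). $\mathcal{G}$ is proper if no two distinct arcs incident to a common vertex share a time label. A temporal path from $u$ to $v$ is a sequence $(e_1,t_1),\dots,(e_k,t_k)$, $k\ge1$, with $t_i\in\lambda(e_i)$, such that $e_1,\dots,e_k$ form a directed path from $u$ to $v$ in $(V,E)$ (distinct vertices) and $t_1\le\dots\le t_k$; it is strict if $t_1<\dots<t_k$. Two temporal graphs on the same vertex set are support equivalent if for every temporal path (of the kind their setting prescribes) in either graph there is one in the other visiting the same vertices in the same order. -}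

module Defs where

open import Data.Nat using (ℕ; _≤_; _<_)
open import Data.Fin using (Fin)
open import Data.List using (List; []; _∷_)
open import Data.List.Membership.Propositional using (_∈_)
open import Data.List.Relation.Unary.Unique.Propositional using (Unique)
open import Data.Product using (Σ; _×_)
open import Data.Sum using (_⊎_)
open import Data.Empty using (⊥)
open import Relation.Binary.PropositionalEquality using (_≡_; _≢_)

-- A directed temporal graph on the vertex set Fin n.
-- label u v is the (finite) set of time labels of the arc (u,v);
-- the arc (u,v) belongs to E iff label u v is nonempty (so every arc
-- has a nonempty finite label set).
-- Time labels are natural numbers (real labels can be renormalized
-- order-preservingly).
record TemporalGraph (n : ℕ) : Set where
  field
    label  : Fin n → Fin n → List ℕ
    noLoop : ∀ u → label u u ≡ []
open TemporalGraph public

IsArc : ∀ {n} → TemporalGraph n → Fin n → Fin n → Set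
IsArc G u v = Σ ℕ λ t → t ∈ label G u v

ShareVertex : ∀ {n} → Fin n → Fin n → Fin n → Fin n → Set
ShareVertex u v u' v' = (u ≡ u' ⊎ u ≡ v') ⊎ (v ≡ u' ⊎ v ≡ v')

Proper : ∀ {n} → TemporalGraph n → Set
Proper G = ∀ u v u' v' (t : ℕ) →
  (u ≡ u' × v ≡ v' → ⊥) → ShareVertex u v u' v' →
  t ∈ label G u v → t ∈ label G u' v' → ⊥

data Hops {n : ℕ} (G : TemporalGraph n) (R : ℕ → ℕ → Set)
     : List (Fin n) → List ℕ → Set where
  one  : ∀ u v t → t ∈ label G u v → Hops G R (u ∷ v ∷ []) (t ∷ [])
  more : ∀ u v ws t t' ts → t ∈ label G u v → R t t' →
         Hops G R (v ∷ ws) (t' ∷ ts) → Hops G R (u ∷ v ∷ ws) (t ∷ t' ∷ ts)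

TemporalPathVia : ∀ {n} → TemporalGraph n → (ℕ → ℕ → Set) → List (Fin n) → Set
TemporalPathVia G R vs = Unique vs × Σ (List ℕ) λ ts → Hops G R vs ts

NonStrictPathVia : ∀ {n} → TemporalGraph n → List (Fin n) → Set
NonStrictPathVia G = TemporalPathVia G _≤_

StrictPathVia : ∀ {n} → TemporalGraph n → List (Fin n) → Set
StrictPathVia G = TemporalPathVia G _<_

-- For each time t of the arc (u,v) of G and each position j ≤ n, give (u,v) in H the label
-- written t·j·u·v in base n+1 (digits from most to least significant); the j-th hop of a
-- path of G uses the label with position j. Along a
-- non-strict path the times t are non-decreasing and the positions j strictly increase,
-- so the new labels strictly increase; conversely the leading digit t of a label is
-- recovered by division, and division is monotone, so strict paths of H project to
-- non-strict paths of G. The two trailing digits u, v make labels of distinct arcs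
-- distinct, so H is proper. Positions stay below n+1 because a path visits distinct
-- vertices.
module Submission where

open import Defs
open import Data.Nat using (ℕ; suc; _+_; _*_; _/_; _%_; _≤_; _<_; NonZero; z<s; s≤s)
open import Data.Nat.Properties
open import Data.Nat.DivMod using (+-distrib-/-∣ʳ; m<n⇒m/n≡0; m*n/n≡m; [m+kn]%n≡m%n; m<n⇒m%n≡m; /-monoˡ-≤)
open import Data.Nat.Divisibility using (n∣m*n)
open import Data.Fin using (Fin; toℕ; zero; suc)
open import Data.Fin.Properties using (toℕ≤n; toℕ-injective; injective⇒≤)
open import Data.List using (List; []; _∷_; length; lookup; map; upTo; cartesianProductWith)
open import Data.List.Membership.Propositional using (_∈_)
open import Data.List.Membership.Propositional.Properties
  using (∈-lookup; ∈-upTo⁺; ∈-upTo⁻; ∈-cartesianProductWith⁺; ∈-cartesianProductWith⁻)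
open import Data.List.Relation.Unary.All as All using ()
open import Data.List.Relation.Unary.AllPairs using (_∷_)
open import Data.List.Relation.Unary.Unique.Propositional using (Unique)
open import Data.Product using (Σ; _×_; _,_)
open import Data.Empty using (⊥-elim)
open import Function.Bundles using (_⇔_; mk⇔)
open import Function.Definitions using (Injective)
open import Relation.Binary.PropositionalEquality

Unique⇒lookup-injective : ∀ {a} {A : Set a} {xs : List A} → Unique xs →
                          Injective _≡_ _≡_ (lookup xs)
Unique⇒lookup-injective (_ ∷ _)    {zero}  {zero}  _  = refl
Unique⇒lookup-injective (x∉xs ∷ _) {zero}  {suc j} eq = ⊥-elim (All.lookup x∉xs (∈-lookup j) eq)
Unique⇒lookup-injective (x∉xs ∷ _) {suc i} {zero}  eq = ⊥-elim (All.lookup x∉xs (∈-lookup i) (sym eq))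
Unique⇒lookup-injective (_ ∷ uniq) {suc i} {suc j} eq = cong suc (Unique⇒lookup-injective uniq eq)

Unique⇒length≤ : ∀ {n} {vs : List (Fin n)} → Unique vs → length vs ≤ n
Unique⇒length≤ uniq = injective⇒≤ (Unique⇒lookup-injective uniq)

Hops-map : ∀ {n} {G H : TemporalGraph n} {R R′ : ℕ → ℕ → Set} (f : ℕ → ℕ) →
           (∀ {u v t} → t ∈ label G u v → f t ∈ label H u v) →
           (∀ {t t′} → R t t′ → R′ (f t) (f t′)) →
           ∀ {vs ts} → Hops G R vs ts → Hops H R′ vs (map f ts)
Hops-map f f∈ f-mono (one u v t t∈)              = one u v (f t) (f∈ t∈)
Hops-map f f∈ f-mono (more u v ws t t′ ts t∈ r h) =
  more u v ws (f t) (f t′) (map f ts) (f∈ t∈) (f-mono r) (Hops-map f f∈ f-mono h)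

module Digits (B : ℕ) .{{_ : NonZero B}} where

  infixl 8 _▹_
  _▹_ : ℕ → ℕ → ℕ
  x ▹ a = a + x * B

  ▹-/ : ∀ x {a} → a < B → x ▹ a / B ≡ x
  ▹-/ x {a} a<B = begin
    (a + x * B) / B      ≡⟨ +-distrib-/-∣ʳ a (n∣m*n x) ⟩
    a / B + x * B / B    ≡⟨ cong₂ _+_ (m<n⇒m/n≡0 a<B) (m*n/n≡m x B) ⟩
    x                    ∎
    where open ≡-Reasoning

  ▹-% : ∀ x {a} → a < B → x ▹ a % B ≡ a
  ▹-% x {a} a<B = trans ([m+kn]%n≡m%n a x B) (m<n⇒m%n≡m a<B)

  ▹-injective : ∀ {x y a b} → a < B → b < B → x ▹ a ≡ y ▹ b → x ≡ y × a ≡ b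
  ▹-injective {x} {y} a<B b<B eq =
    trans (sym (▹-/ x a<B)) (trans (cong (_/ B) eq) (▹-/ y b<B)) ,
    trans (sym (▹-% x a<B)) (trans (cong (_% B) eq) (▹-% y b<B))

  ▹-monoˡ-< : ∀ {x y} a b → x < y → a < B → x ▹ a < y ▹ b
  ▹-monoˡ-< {x} {y} a b x<y a<B = begin-strict
    a + x * B   <⟨ +-monoˡ-< (x * B) a<B ⟩
    suc x * B   ≤⟨ *-monoˡ-≤ B x<y ⟩
    y * B       ≤⟨ m≤n+m (y * B) b ⟩
    b + y * B   ∎
    where open ≤-Reasoning

module Construction {n : ℕ} (G : TemporalGraph n) where

  B : ℕ
  B = suc n

  open Digits B

  toℕ<B : (u : Fin n) → toℕ u < B
  toℕ<B u = s≤s (toℕ≤n u)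

  code : ℕ → ℕ → Fin n → Fin n → ℕ
  code t j u v = t ▹ j ▹ toℕ u ▹ toℕ v

  decode : ℕ → ℕ
  decode s = s / B / B / B

  decode-code : ∀ t {j} u v → j < B → decode (code t j u v) ≡ t
  decode-code t {j} u v j<B = begin
    code t j u v / B / B / B  ≡⟨ cong (λ s → s / B / B) (▹-/ (t ▹ j ▹ toℕ u) (toℕ<B v)) ⟩
    t ▹ j ▹ toℕ u / B / B     ≡⟨ cong (_/ B) (▹-/ (t ▹ j) (toℕ<B u)) ⟩
    t ▹ j / B                 ≡⟨ ▹-/ t j<B ⟩
    t                         ∎
    where open ≡-Reasoning

  decode-mono : ∀ {s s′} → s ≤ s′ → decode s ≤ decode s′
  decode-mono s≤s′ = /-monoˡ-≤ B (/-monoˡ-≤ B (/-monoˡ-≤ B s≤s′))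

  code-arc-injective : ∀ t t′ j j′ {u u′ v v′} → code t j u v ≡ code t′ j′ u′ v′ → u ≡ u′ × v ≡ v′
  code-arc-injective t t′ j j′ {u} {u′} {v} {v′} eq
    with eq′ , v≡v′ ← ▹-injective {t ▹ j ▹ toℕ u} {t′ ▹ j′ ▹ toℕ u′} (toℕ<B v) (toℕ<B v′) eq
    with _ , u≡u′ ← ▹-injective {t ▹ j} {t′ ▹ j′} (toℕ<B u) (toℕ<B u′) eq′
    = toℕ-injective u≡u′ , toℕ-injective v≡v′

  code-<-next-hop : ∀ {t t′} j u v w x → t ≤ t′ → code t j u v < code t′ (suc j) w x
  code-<-next-hop {t} {t′} j u v w x t≤t′ =
    ▹-monoˡ-< (toℕ v) (toℕ x) (▹-monoˡ-< (toℕ u) (toℕ w) t▹j<t′▹1+j (toℕ<B u)) (toℕ<B v)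
    where
      t▹j<t′▹1+j : t ▹ j < t′ ▹ suc j
      t▹j<t′▹1+j = +-mono-<-≤ (n<1+n j) (*-monoˡ-≤ B t≤t′)

  labelH : Fin n → Fin n → List ℕ
  labelH u v = cartesianProductWith (λ t j → code t j u v) (label G u v) (upTo B)

  H : TemporalGraph n
  H = record
    { label  = labelH
    ; noLoop = λ u → cong (λ ts → cartesianProductWith (λ t j → code t j u u) ts (upTo B)) (noLoop G u)
    }

  code∈labelH : ∀ {u v t j} → t ∈ label G u v → j < B → code t j u v ∈ labelH u v
  code∈labelH t∈ j<B = ∈-cartesianProductWith⁺ _ t∈ (∈-upTo⁺ j<B)

  ∈labelH⇒code : ∀ {u v s} → s ∈ labelH u v →
                 Σ ℕ λ t → Σ ℕ λ j → t ∈ label G u v × j < B × s ≡ code t j u v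
  ∈labelH⇒code {u} {v} s∈ with t , j , t∈ , j∈ , eq ← ∈-cartesianProductWith⁻ _ (label G u v) (upTo B) s∈ =
    t , j , t∈ , ∈-upTo⁻ j∈ , eq

  H-proper : Proper H
  H-proper u v u′ v′ s arcs≢ _ s∈ s∈′
    with t , j , _ , _ , refl ← ∈labelH⇒code s∈
    with t′ , j′ , _ , _ , eq ← ∈labelH⇒code s∈′
    = arcs≢ (code-arc-injective t t′ j j′ eq)

  decode∈label : ∀ {u v s} → s ∈ labelH u v → decode s ∈ label G u v
  decode∈label {u} {v} s∈ with t , j , t∈ , j<B , refl ← ∈labelH⇒code s∈ =
    subst (_∈ label G u v) (sym (decode-code t u v j<B)) t∈

  relabel : ℕ → List (Fin n) → List ℕ → List ℕ
  relabel j (u ∷ v ∷ ws) (t ∷ ts) = code t j u v ∷ relabel (suc j) (v ∷ ws) ts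
  relabel _ _                _        = []

  Hops-relabel : ∀ {vs ts} j → j + length vs ≤ B → Hops G _≤_ vs ts → Hops H _<_ vs (relabel j vs ts)
  Hops-relabel j j+|vs|≤B (one u v t t∈) =
    one u v _ (code∈labelH t∈ (<-≤-trans (m<m+n j z<s) j+|vs|≤B))
  Hops-relabel j j+|vs|≤B (more u v [] t t′ ts t∈ t≤t′ ())
  Hops-relabel j j+|vs|≤B (more u v (w ∷ ws) t t′ ts t∈ t≤t′ h) =
    more u v _ _ _ _ (code∈labelH t∈ (<-≤-trans (m<m+n j z<s) j+|vs|≤B))
      (code-<-next-hop j u v v w t≤t′)
      (Hops-relabel (suc j) (subst (_≤ B) (+-suc j _) j+|vs|≤B) h)

  Hops-decode : ∀ {vs ts} → Hops H _<_ vs ts → Hops G _≤_ vs (map decode ts)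
  Hops-decode = Hops-map decode decode∈label (λ s<s′ → decode-mono (<⇒≤ s<s′))

theorem14 : (n : ℕ) (G : TemporalGraph n) →
    Σ (TemporalGraph n) λ H → Proper H ×
    ((vs : List (Fin n)) → Unique vs → 2 ≤ length vs →
    (NonStrictPathVia G vs ⇔ StrictPathVia H vs))
theorem14 n G = H , H-proper , λ vs uniq _ → mk⇔
  (λ (uniq′ , _ , hops) → uniq′ , _ , Hops-relabel 0 (m≤n⇒m≤1+n (Unique⇒length≤ uniq)) hops)
  (λ (uniq′ , _ , hops) → uniq′ , _ , Hops-decode hops)
  where open Construction G
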